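{- Let $\mathcal D$ be a maximal ASPD on a finite set $A$ with $n=|A|$ alternatives, and let $x,y\in A$ be distinct. Then: (1) $x$ and $y$ are contiguous in $\mathcal D$, i.e. there exist $\omega\in\mathcal D$ and $1\le i\le n-1$ with $\{x,y\}=\{\omega(i),\omega(i+1)\}$. (2) Suppose $n\ge3$, let $a_1,a_2$ be the two bottom alternatives of $\mathcal D$ and $A'=A\setminus\{a_1,a_2\}$, and let $\mathcal D'=\{\omega_{A'}:\omega\in\mathcal D,\ \omega(n)=a_1,\ \omega(n-1)=a_2\}$. If $x,y\in A'$, then a topmost contiguous occurrence of $x$ and $y$ appears in $\mathcal D'$; that is, $\min\{i:\exists\omega\in\mathcal D,\ \{x,y\}=\{\omega(i),\omega(i+1)\}\}=\min\{i:\exists\omega'\in\mathcal D',\ \{x,y\}=\{\omega'(i),\omega'(i+1)\}\}$.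
   Context: With $n=|A|$, a preference on $A$ is a bijection $\omega\colon[n]\to A$, written $\omega(1)\cdots\omega(n)$ ($\omega(1)$ most preferred); $\mathcal L(A)$ denotes all preferences, and a domain is a subset of $\mathcal L(A)$. For $S\subseteq A$, $\omega_S$ is the preference on $S$ listing the elements of $S$ in their $\omega$-order, and $\mathcal D_S=\{\omega_S:\omega\in\mathcal D\}$. An alternative $x$ is a bottom alternative of $\mathcal D$ if $\omega(|A|)=x$ for some $\omega\in\mathcal D$. $\mathcal D$ is an ASPD (Arrow's single-peaked domain) if for every 3-element $T\subseteq A$ some $x\in T$ is not a bottom alternative of $\mathcal D_T$; it is maximal if no strictly larger domain in $\mathcal L(A)$ is an ASPD. Known fact: a maximal ASPD with $n\ge2$ has exactly two bottom alternatives, and $|\mathcal D|=2^{n-1}$. -}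

module Defs where

open import Data.Nat using (ℕ; zero; suc; _≤_; _∸_)
open import Data.Fin using (Fin)
open import Data.Fin.Subset using (Subset; _∈_; ∣_∣; ∁; ⁅_⁆; _∪_)
open import Data.Fin.Subset.Properties using (_∈?_)
open import Data.List using (List; []; _∷_; filter; allFin)
open import Data.List.Relation.Binary.Permutation.Propositional using (_↭_)
open import Data.Maybe using (Maybe; just; nothing)
open import Data.Product using (Σ; ∃; _×_; _,_)
open import Data.Sum using (_⊎_)
open import Relation.Binary.PropositionalEquality using (_≡_)
open import Relation.Nullary using (¬_)

-- Alternatives: A = Fin n.  A preference on a set S is represented as the
-- list ω(1) ω(2) … ω(|S|) (most preferred first).

-- 0-indexed lookup: nth ω i ≡ just z  means  ω(i+1) = z.
nth : {X : Set} → List X → ℕ → Maybe X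
nth []       _       = nothing
nth (z ∷ _)  zero    = just z
nth (_ ∷ zs) (suc i) = nth zs i

IsPref : (n : ℕ) → List (Fin n) → Set
IsPref n ω = ω ↭ allFin n

Domain : (n : ℕ) → Set₁
Domain n = List (Fin n) → Set

IsDomain : (n : ℕ) → Domain n → Set
IsDomain n D = ∀ ω → D ω → IsPref n ω

restrict : {n : ℕ} → Subset n → List (Fin n) → List (Fin n)
restrict S ω = filter (_∈? S) ω

RestrictDom : {n : ℕ} → Domain n → Subset n → Domain n
RestrictDom D S l = ∃ λ ω → D ω × l ≡ restrict S ω

-- x is a bottom alternative of a domain E of preferences on a k-element set:
-- ω(k) = x for some ω ∈ E.
IsBottom : {n : ℕ} → Domain n → ℕ → Fin n → Set
IsBottom E k x = ∃ λ ω → E ω × nth ω (k ∸ 1) ≡ just x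

IsASPD : (n : ℕ) → Domain n → Set
IsASPD n D = ∀ (T : Subset n) → ∣ T ∣ ≡ 3 →
  ∃ λ x → x ∈ T × ¬ IsBottom (RestrictDom D T) 3 x

_⊆D_ : {n : ℕ} → Domain n → Domain n → Set
D ⊆D E = ∀ ω → D ω → E ω

IsMaximalASPD : (n : ℕ) → Domain n → Set₁
IsMaximalASPD n D =
  IsDomain n D × IsASPD n D ×
  (∀ (E : Domain n) → IsDomain n E → D ⊆D E → IsASPD n E → E ⊆D D)

-- {x,y} = {ω(i+1), ω(i+2)}  (0-indexed i).
AdjAt : {X : Set} → List X → ℕ → X → X → Set
AdjAt ω i x y =
  (nth ω i ≡ just x × nth ω (suc i) ≡ just y) ⊎
  (nth ω i ≡ just y × nth ω (suc i) ≡ just x)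

ContigAt : {n : ℕ} → Domain n → ℕ → Fin n → Fin n → Set
ContigAt E i x y = ∃ λ ω → E ω × AdjAt ω i x y

IsMinContig : {n : ℕ} → Domain n → Fin n → Fin n → ℕ → Set
IsMinContig E x y m = ContigAt E m x y × (∀ k → ContigAt E k x y → m ≤ k)

without2 : {n : ℕ} → Fin n → Fin n → Subset n
without2 a₁ a₂ = ∁ (⁅ a₁ ⁆ ∪ ⁅ a₂ ⁆)

Dprime : (n : ℕ) → Domain n → Fin n → Fin n → Domain n
Dprime n D a₁ a₂ l = ∃ λ ω → D ω × nth ω (n ∸ 1) ≡ just a₁ ×
  nth ω (n ∸ 2) ≡ just a₂ × l ≡ restrict (without2 a₁ a₂) ω

{-# OPTIONS --safe #-}
module Submission where

-- Write f(T) for the alternative of a triple T that the ASPD property keeps off the bottom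
-- of D_T. By maximality, D is exactly the set of preferences in which no triple T has f(T)
-- at its bottom. Preferences of D can therefore be assembled from the bottom up: c can be
-- put directly above a tail s of a preference of D iff f(T) ≠ c for every triple T ∋ c
-- disjoint from s, and a second use of maximality shows that the alternative directly
-- above s is never the only one that fits. Hence every t ≠ f(T) is the bottom of T in
-- some preference of D.
-- Fix x ≠ y and call z above if f{x,y,z} = z, i.e. z precedes x or y in every preference
-- of D. When x and y are adjacent, all above alternatives precede them, so the position
-- is at least their number. Conversely, lowering all other alternatives and then putting
-- y and x on top yields x, y right after the above alternatives. The bottoms a₁, a₂ are
-- not above, so starting from the tail a₂ a₁ the same preference restricts to a witness
-- in D′ at the same position.

open import Defs
open import Data.Nat using (ℕ; zero; suc; _≤_; _<_; _∸_; _+_; z≤n; s≤s)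
import Data.Nat.Properties as ℕ
open import Data.Fin as Fin using (Fin)
open import Data.Fin.Properties using (any?) renaming (_≟_ to _≟ᶠ_)
open import Data.Fin.Subset using (Subset; _∈_; _∉_; _⊆_; ∣_∣; ⁅_⁆; _∪_; inside; outside; Nonempty)
open import Data.Fin.Subset.Properties
  using ( _∈?_; anySubset?; nonempty?; Empty-unique; ∣⊥∣≡0; x∈⁅x⁆; x∈⁅y⁆⇒x≡y; ∣⁅x⁆∣≡1; x∈∁p⇒x∉p; x∉p⇒x∈∁p
        ; x∈p∪q⁻; x∈p∪q⁺; ∪-identityˡ; ∪-idem; ∪-assoc; ∪-comm; p⊆q⇒∣p∣≤∣q∣; p⊂q⇒∣p∣<∣q∣; ⊆-antisym )
open import Data.Vec.Base as Vec using (_∷_)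
open import Data.List using (List; []; _∷_; _++_; length; filter; allFin; [_]; last; tabulate)
import Data.List.Properties as List
open import Data.List.Membership.Propositional using (find) renaming (_∈_ to _∈ₗ_; _∉_ to _∉ₗ_)
open import Data.List.Membership.Propositional.Properties using (∈-allFin; ∈-filter⁻; ∈-++⁺ʳ; ∈-++⁻; ∈-∃++)
import Data.List.Membership.DecPropositional as DecMembership
open import Data.List.Relation.Unary.Any using (here; there)
open import Data.List.Relation.Unary.All as All using (All; []; _∷_)
open import Data.List.Relation.Unary.All.Properties using (¬All⇒Any¬)
open import Data.List.Relation.Unary.AllPairs using ([]; _∷_)
open import Data.List.Relation.Unary.Unique.Propositional using (Unique)
import Data.List.Relation.Unary.Unique.Propositional.Properties as Unique
open import Data.List.Relation.Binary.Permutation.Propositional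
  using (_↭_; ↭-sym; ↭-trans; ↭-refl; swap; ↭⇒↭ₛ; module PermutationReasoning)
import Data.List.Relation.Binary.Permutation.Propositional.Properties as Perm
import Data.List.Relation.Binary.Permutation.Setoid.Properties as PermSetoid
open import Data.Maybe using (Maybe; just; nothing; _<∣>_)
open import Data.Maybe.Properties using (just-injective; <∣>-identityʳ) renaming (≡-dec to ≡-decᵐ)
open import Data.Product using (Σ; ∃; ∃₂; _×_; _,_; proj₁; proj₂)
open import Data.Sum using (_⊎_; inj₁; inj₂)
open import Data.Empty using (⊥; ⊥-elim)
open import Function using (_∘_; id)
open import Relation.Binary.Definitions using (DecidableEquality)
open import Relation.Binary.PropositionalEquality
  using (_≡_; _≢_; refl; sym; trans; cong; cong₂; subst; setoid; module ≡-Reasoning)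
open import Relation.Nullary using (¬_; Dec; yes; no; ¬?)
open import Relation.Nullary.Decidable using (_×-dec_)
open import Relation.Nullary.Negation using (¬¬-map)
open import Relation.Unary using (Pred; Decidable; ∁)

suc<⇒<∸1 : ∀ {i m} → suc i < m → i < m ∸ 1
suc<⇒<∸1 {m = suc m} (s≤s i<m) = i<m

module _ {A : Set} where

  last-∷ : (x : A) (xs : List A) (m : Maybe A) → last (x ∷ xs) <∣> m ≡ last (x ∷ xs)
  last-∷ x []       m = refl
  last-∷ x (y ∷ xs) m = last-∷ y xs m

  last-++ : (xs ys : List A) → last (xs ++ ys) ≡ last ys <∣> last xs
  last-++ []           ys       = sym (<∣>-identityʳ (last ys))
  last-++ (x ∷ [])     []       = refl
  last-++ (x ∷ [])     (y ∷ ys) = sym (last-∷ y ys (just x))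
  last-++ (x ∷ y ∷ xs) ys       = last-++ (y ∷ xs) ys

  last≡just⇒∷ʳ : (xs : List A) {x : A} → last xs ≡ just x → ∃ λ ys → xs ≡ ys ++ [ x ]
  last≡just⇒∷ʳ (x ∷ [])     refl = [] , refl
  last≡just⇒∷ʳ (x ∷ y ∷ xs) eq   with ys , eq′ ← last≡just⇒∷ʳ (y ∷ xs) eq = x ∷ ys , cong (x ∷_) eq′

  last≡nothing⇒[] : (xs : List A) → last xs ≡ nothing → xs ≡ []
  last≡nothing⇒[] []           _  = refl
  last≡nothing⇒[] (x ∷ y ∷ xs) eq with () ← last≡nothing⇒[] (y ∷ xs) eq

  nth-pred-length : (xs : List A) → nth xs (length xs ∸ 1) ≡ last xs
  nth-pred-length []           = refl
  nth-pred-length (x ∷ [])     = refl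
  nth-pred-length (x ∷ y ∷ xs) = nth-pred-length (y ∷ xs)

  nth-++ : (xs ys : List A) (i : ℕ) → nth (xs ++ ys) (length xs + i) ≡ nth ys i
  nth-++ []       ys i = refl
  nth-++ (x ∷ xs) ys i = nth-++ xs ys i

  nth≡just⇒< : (xs : List A) (i : ℕ) {x : A} → nth xs i ≡ just x → i < length xs
  nth≡just⇒< (y ∷ xs) zero    _  = s≤s z≤n
  nth≡just⇒< (y ∷ xs) (suc i) eq = s≤s (nth≡just⇒< xs i eq)

  adjacent-++ : (q : List A) {u v : A} (r : List A) →
    nth (q ++ u ∷ v ∷ r) (length q) ≡ just u × nth (q ++ u ∷ v ∷ r) (suc (length q)) ≡ just v
  adjacent-++ []      r = refl , refl
  adjacent-++ (_ ∷ q) r = adjacent-++ q r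

  adjacent⇒++ : (l : List A) (k : ℕ) {u v : A} → nth l k ≡ just u → nth l (suc k) ≡ just v →
    ∃₂ λ q r → l ≡ q ++ u ∷ v ∷ r × length q ≡ k
  adjacent⇒++ (u ∷ v ∷ r) zero    refl refl = [] , r , refl , refl
  adjacent⇒++ (w ∷ l)     (suc k) eu   ev   with adjacent⇒++ l k eu ev
  ... | q , r , refl , refl = w ∷ q , r , refl , refl

  nth-last-two : (ws : List A) {a b : A} {m : ℕ} → length (ws ++ a ∷ b ∷ []) ≡ m →
    nth (ws ++ a ∷ b ∷ []) (m ∸ 1) ≡ just b × nth (ws ++ a ∷ b ∷ []) (m ∸ 2) ≡ just a
  nth-last-two ws {a} {b} refl = trans (nth-pred-length l) (last-++ ws (a ∷ b ∷ [])) , (begin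
    nth l (length l ∸ 2)        ≡⟨ cong (λ k → nth l (k ∸ 2)) (List.length-++ ws) ⟩
    nth l (length ws + 2 ∸ 2)   ≡⟨ cong (nth l) (ℕ.m+n∸n≡m (length ws) 2) ⟩
    nth l (length ws)           ≡⟨ cong (nth l) (ℕ.+-identityʳ (length ws)) ⟨
    nth l (length ws + 0)       ≡⟨ nth-++ ws (a ∷ b ∷ []) 0 ⟩
    just a                      ∎)
    where
    open ≡-Reasoning
    l : List A
    l = ws ++ a ∷ b ∷ []

  adjAt⇒< : (ω : List A) {i : ℕ} {x y : A} → AdjAt ω i x y → i < length ω ∸ 1
  adjAt⇒< ω {i} (inj₁ (_ , e)) = suc<⇒<∸1 (nth≡just⇒< ω (suc i) e)
  adjAt⇒< ω {i} (inj₂ (_ , e)) = suc<⇒<∸1 (nth≡just⇒< ω (suc i) e)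

  adjAt⇒++ : {l : List A} {k : ℕ} {x y : A} → AdjAt l k x y →
    ∃₂ λ q r → length q ≡ k × (l ≡ q ++ x ∷ y ∷ r ⊎ l ≡ q ++ y ∷ x ∷ r)
  adjAt⇒++ {l} {k} (inj₁ (e₁ , e₂)) with q , r , eq , len ← adjacent⇒++ l k e₁ e₂ = q , r , len , inj₁ eq
  adjAt⇒++ {l} {k} (inj₂ (e₁ , e₂)) with q , r , eq , len ← adjacent⇒++ l k e₁ e₂ = q , r , len , inj₂ eq

  Unique-++⁻ʳ : (xs : List A) {ys : List A} → Unique (xs ++ ys) → Unique ys
  Unique-++⁻ʳ []       u       = u
  Unique-++⁻ʳ (x ∷ xs) (_ ∷ u) = Unique-++⁻ʳ xs u

  Unique-++∷∷⇒∉ : (xs : List A) {u v : A} {r : List A} → Unique (xs ++ u ∷ v ∷ r) → u ∉ₗ r × v ∉ₗ r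
  Unique-++∷∷⇒∉ xs uniq with u∉ ∷ v∉ ∷ _ ← Unique-++⁻ʳ xs uniq =
    (λ u∈r → All.lookup u∉ (there u∈r) refl) , (λ v∈r → All.lookup v∉ v∈r refl)

  Unique-++⇒disjoint : (xs : List A) {ys : List A} {z : A} → Unique (xs ++ ys) → z ∈ₗ xs → z ∉ₗ ys
  Unique-++⇒disjoint (x ∷ xs) (x∉ ∷ _) (here refl) z∈ys =
    All.lookup x∉ (∈-++⁺ʳ xs z∈ys) refl
  Unique-++⇒disjoint (x ∷ xs) (_ ∷ u) (there z∈xs) = Unique-++⇒disjoint xs u z∈xs

  Unique-++∷⇒∉ : (xs : List A) {y : A} {ys : List A} → Unique (xs ++ y ∷ ys) → y ∉ₗ ys
  Unique-++∷⇒∉ xs u with x∉ ∷ _ ← Unique-++⁻ʳ xs u = λ y∈ys → All.lookup x∉ y∈ys refl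

  ∈-++-∉ : (p : List A) {s : List A} {c : A} → c ∈ₗ p ++ s → c ∉ₗ s → ∃₂ λ p₁ p₂ → p ≡ p₁ ++ c ∷ p₂
  ∈-++-∉ p c∈ c∉s with ∈-++⁻ p c∈
  ... | inj₁ c∈p = ∈-∃++ c∈p
  ... | inj₂ c∈s = ⊥-elim (c∉s c∈s)

  moveDown-↭ : (p₁ p₂ : List A) (c : A) (s : List A) → (p₁ ++ c ∷ p₂) ++ s ↭ (p₁ ++ p₂) ++ c ∷ s
  moveDown-↭ p₁ p₂ c s = begin
    (p₁ ++ c ∷ p₂) ++ s  ≡⟨ List.++-assoc p₁ (c ∷ p₂) s ⟩
    p₁ ++ c ∷ p₂ ++ s    ↭⟨ Perm.++⁺ˡ p₁ (↭-sym (Perm.shift c p₂ s)) ⟩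
    p₁ ++ p₂ ++ c ∷ s    ≡⟨ List.++-assoc p₁ p₂ (c ∷ s) ⟨
    (p₁ ++ p₂) ++ c ∷ s  ∎
    where open PermutationReasoning

  ∈-++-∉⇒↭ : (p : List A) {s : List A} {c : A} → c ∈ₗ p ++ s → c ∉ₗ s → ∃ λ p′ → p ++ s ↭ p′ ++ c ∷ s
  ∈-++-∉⇒↭ p {s} {c} c∈ c∉s with p₁ , p₂ , refl ← ∈-++-∉ p c∈ c∉s = p₁ ++ p₂ , moveDown-↭ p₁ p₂ c s

  module _ {p q} {P : Pred A p} {Q : Pred A q} (P? : Decidable P) (Q? : Decidable Q) where

    filter-filter-⊆ : (∀ {z} → P z → Q z) → (xs : List A) → filter P? (filter Q? xs) ≡ filter P? xs
    filter-filter-⊆ P⊆Q []       = refl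
    filter-filter-⊆ P⊆Q (x ∷ xs) with Q? x
    ... | no ¬qx = trans (filter-filter-⊆ P⊆Q xs) (sym (List.filter-reject P? (λ px → ¬qx (P⊆Q px))))
    ... | yes _ with P? x
    ...   | yes _ = cong (x ∷_) (filter-filter-⊆ P⊆Q xs)
    ...   | no _  = filter-filter-⊆ P⊆Q xs

  filter≡[]⇒All∁ : ∀ {p} {P : Pred A p} (P? : Decidable P) (xs : List A) → filter P? xs ≡ [] → All (∁ P) xs
  filter≡[]⇒All∁ P? []       _  = []
  filter≡[]⇒All∁ P? (x ∷ xs) eq with P? x
  ... | no ¬px = ¬px ∷ filter≡[]⇒All∁ P? xs eq

  lowest-∉ : DecidableEquality A → (ω : List A) {s : List A} {z : A} → z ∈ₗ ω → z ∉ₗ s →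
    ∃ λ c → c ∉ₗ s × ∃₂ λ q r → ω ≡ q ++ c ∷ r × All (_∈ₗ s) r
  lowest-∉ _≟_ (w ∷ ws) {s} {z} z∈ z∉s with All.all? (λ v → DecMembership._∈?_ _≟_ v s) ws
  ... | yes ws⊆s = w , w∉s z∈ , [] , ws , refl , ws⊆s
    where
    w∉s : z ∈ₗ w ∷ ws → w ∉ₗ s
    w∉s (here refl)  = z∉s
    w∉s (there z∈ws) = ⊥-elim (z∉s (All.lookup ws⊆s z∈ws))
  ... | no ws⊈s with v , v∈ws , v∉s ← find (¬All⇒Any¬ (λ v → DecMembership._∈?_ _≟_ v s) ws ws⊈s)
                with c , c∉s , q , r , refl , r⊆s ← lowest-∉ _≟_ ws v∈ws v∉s =
    c , c∉s , w ∷ q , r , refl , r⊆s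

bounded-∷-rec : {A : Set} {P : List A → Set} {R : Set} (N : ℕ) →
  (∀ {s} → P s → length s ≤ N) →
  (∀ {s} → P s → R ⊎ ∃ λ c → P (c ∷ s)) →
  ∀ {s} → P s → R
bounded-∷-rec {P = P} {R} N bound step = go N (ℕ.m≤m+n N _)
  where
  go : ∀ k {s} → N ≤ k + length s → P s → R
  go k le ps with step ps
  ... | inj₁ r = r
  go zero    le ps | inj₂ (c , pcs) = ⊥-elim (ℕ.<-irrefl refl (ℕ.≤-trans (bound pcs) le))
  go (suc k) le ps | inj₂ (c , pcs) = go k (ℕ.≤-trans le (ℕ.≤-reflexive (sym (ℕ.+-suc k _)))) pcs

x∉p⇒∣⁅x⁆∪p∣≡1+∣p∣ : ∀ {n} {x : Fin n} {p : Subset n} → x ∉ p → ∣ ⁅ x ⁆ ∪ p ∣ ≡ suc ∣ p ∣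
x∉p⇒∣⁅x⁆∪p∣≡1+∣p∣ {x = Fin.zero}  {outside ∷ p} _   = cong suc (cong ∣_∣ (∪-identityˡ p))
x∉p⇒∣⁅x⁆∪p∣≡1+∣p∣ {x = Fin.zero}  {inside ∷ p}  x∉p = ⊥-elim (x∉p Vec.here)
x∉p⇒∣⁅x⁆∪p∣≡1+∣p∣ {x = Fin.suc x} {outside ∷ p} x∉p = x∉p⇒∣⁅x⁆∪p∣≡1+∣p∣ (x∉p ∘ Vec.there)
x∉p⇒∣⁅x⁆∪p∣≡1+∣p∣ {x = Fin.suc x} {inside ∷ p}  x∉p = cong suc (x∉p⇒∣⁅x⁆∪p∣≡1+∣p∣ (x∉p ∘ Vec.there))

module _ {n : ℕ} where

  pair : Fin n → Fin n → Subset n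
  pair a b = ⁅ a ⁆ ∪ ⁅ b ⁆

  triple : Fin n → Fin n → Fin n → Subset n
  triple a b c = ⁅ a ⁆ ∪ pair b c

  ∈-pair⁻ : ∀ {a b z} → z ∈ pair a b → z ≡ a ⊎ z ≡ b
  ∈-pair⁻ {a} {b} z∈ with x∈p∪q⁻ ⁅ a ⁆ ⁅ b ⁆ z∈
  ... | inj₁ z∈a = inj₁ (x∈⁅y⁆⇒x≡y a z∈a)
  ... | inj₂ z∈b = inj₂ (x∈⁅y⁆⇒x≡y b z∈b)

  ∈-pair⁺ : ∀ {a b z} → z ≡ a ⊎ z ≡ b → z ∈ pair a b
  ∈-pair⁺ (inj₁ refl) = x∈p∪q⁺ (inj₁ (x∈⁅x⁆ _))
  ∈-pair⁺ (inj₂ refl) = x∈p∪q⁺ (inj₂ (x∈⁅x⁆ _))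

  ∈-triple⁻ : ∀ {a b c z} → z ∈ triple a b c → z ≡ a ⊎ z ≡ b ⊎ z ≡ c
  ∈-triple⁻ {a} {b} {c} z∈ with x∈p∪q⁻ ⁅ a ⁆ (pair b c) z∈
  ... | inj₁ z∈a  = inj₁ (x∈⁅y⁆⇒x≡y a z∈a)
  ... | inj₂ z∈bc = inj₂ (∈-pair⁻ z∈bc)

  ∈-triple⁺ : ∀ {a b c z} → z ≡ a ⊎ z ≡ b ⊎ z ≡ c → z ∈ triple a b c
  ∈-triple⁺ (inj₁ refl)  = x∈p∪q⁺ (inj₁ (x∈⁅x⁆ _))
  ∈-triple⁺ (inj₂ z∈bc) = x∈p∪q⁺ (inj₂ (∈-pair⁺ z∈bc))

  ∣pair∣≤2 : (a b : Fin n) → ∣ pair a b ∣ ≤ 2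
  ∣pair∣≤2 a b with a ≟ᶠ b
  ... | yes refl = ℕ.≤-trans (ℕ.≤-reflexive (trans (cong ∣_∣ (∪-idem ⁅ a ⁆)) (∣⁅x⁆∣≡1 a))) (s≤s z≤n)
  ... | no a≢b   =
    ℕ.≤-reflexive (trans (x∉p⇒∣⁅x⁆∪p∣≡1+∣p∣ (a≢b ∘ x∈⁅y⁆⇒x≡y b)) (cong suc (∣⁅x⁆∣≡1 b)))

  ∣triple∣≡3 : {a b c : Fin n} → a ≢ b → a ≢ c → b ≢ c → ∣ triple a b c ∣ ≡ 3
  ∣triple∣≡3 {a} {b} {c} a≢b a≢c b≢c = begin
    ∣ triple a b c ∣  ≡⟨ x∉p⇒∣⁅x⁆∪p∣≡1+∣p∣ a∉bc ⟩
    suc ∣ pair b c ∣  ≡⟨ cong suc (x∉p⇒∣⁅x⁆∪p∣≡1+∣p∣ (λ b∈c → b≢c (x∈⁅y⁆⇒x≡y c b∈c))) ⟩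
    2 + ∣ ⁅ c ⁆ ∣     ≡⟨ cong (2 +_) (∣⁅x⁆∣≡1 c) ⟩
    3                 ∎
    where
    open ≡-Reasoning
    a∉bc : a ∉ pair b c
    a∉bc a∈bc with ∈-pair⁻ a∈bc
    ... | inj₁ a≡b = a≢b a≡b
    ... | inj₂ a≡c = a≢c a≡c

  ∣p∣≡3⇒nonempty : {T : Subset n} → ∣ T ∣ ≡ 3 → Nonempty T
  ∣p∣≡3⇒nonempty {T} ∣T∣≡3 with nonempty? T
  ... | yes ne = ne
  ... | no ¬ne with () ← trans (sym ∣T∣≡3) (trans (cong ∣_∣ (Empty-unique ¬ne)) (∣⊥∣≡0 n))

  ∃-third : {T : Subset n} → ∣ T ∣ ≡ 3 → (a b : Fin n) → ∃ λ z → z ∈ T × z ≢ a × z ≢ b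
  ∃-third {T} ∣T∣≡3 a b with any? (λ z → z ∈? T ×-dec ¬? (z ≟ᶠ a) ×-dec ¬? (z ≟ᶠ b))
  ... | yes found = found
  ... | no ∄ =
    ⊥-elim (ℕ.<⇒≱ (ℕ.≤-reflexive (sym ∣T∣≡3)) (ℕ.≤-trans (p⊆q⇒∣p∣≤∣q∣ T⊆ab) (∣pair∣≤2 a b)))
    where
    T⊆ab : T ⊆ pair a b
    T⊆ab {z} z∈T with z ≟ᶠ a | z ≟ᶠ b
    ... | yes z≡a | _       = ∈-pair⁺ (inj₁ z≡a)
    ... | no _    | yes z≡b = ∈-pair⁺ (inj₂ z≡b)
    ... | no z≢a  | no z≢b  = ⊥-elim (∄ (z , z∈T , z≢a , z≢b))

  triple-swap : (a b c : Fin n) → triple a b c ≡ triple b a c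
  triple-swap a b c = begin
    ⁅ a ⁆ ∪ ⁅ b ⁆ ∪ ⁅ c ⁆      ≡⟨ ∪-assoc ⁅ a ⁆ ⁅ b ⁆ ⁅ c ⁆ ⟨
    (⁅ a ⁆ ∪ ⁅ b ⁆) ∪ ⁅ c ⁆    ≡⟨ cong (_∪ ⁅ c ⁆) (∪-comm ⁅ a ⁆ ⁅ b ⁆) ⟩
    (⁅ b ⁆ ∪ ⁅ a ⁆) ∪ ⁅ c ⁆    ≡⟨ ∪-assoc ⁅ b ⁆ ⁅ a ⁆ ⁅ c ⁆ ⟩
    ⁅ b ⁆ ∪ ⁅ a ⁆ ∪ ⁅ c ⁆      ∎
    where open ≡-Reasoning

  ∣triple∣≡3⇒≢ : {a b c : Fin n} → ∣ triple a b c ∣ ≡ 3 → c ≢ a × c ≢ b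
  ∣triple∣≡3⇒≢ {a} {b} {c} ∣abc∣≡3 = two-elements ∘ inj₁ , two-elements ∘ inj₂
    where
    two-elements : c ≡ a ⊎ c ≡ b → ⊥
    two-elements c∈ab with z , z∈abc , z≢a , z≢b ← ∃-third ∣abc∣≡3 a b
                      with ∈-triple⁻ {a = a} {b = b} {c = c} z∈abc | c∈ab
    ... | inj₁ z≡a        | _           = z≢a z≡a
    ... | inj₂ (inj₁ z≡b) | _           = z≢b z≡b
    ... | inj₂ (inj₂ refl) | inj₁ z≡a   = z≢a z≡a
    ... | inj₂ (inj₂ refl) | inj₂ z≡b   = z≢b z≡b

  triple-⊆ : {T : Subset n} {a b c : Fin n} → a ∈ T → b ∈ T → c ∈ T → triple a b c ⊆ T
  triple-⊆ a∈T b∈T c∈T w∈abc with ∈-triple⁻ w∈abc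
  ... | inj₁ refl        = a∈T
  ... | inj₂ (inj₁ refl) = b∈T
  ... | inj₂ (inj₂ refl) = c∈T

  triple-complete : {T : Subset n} → ∣ T ∣ ≡ 3 → {a b c : Fin n} → a ∈ T → b ∈ T → c ∈ T →
    a ≢ b → a ≢ c → b ≢ c → T ⊆ triple a b c
  triple-complete {T} ∣T∣≡3 {a} {b} {c} a∈T b∈T c∈T a≢b a≢c b≢c {z} z∈T with z ∈? triple a b c
  ... | yes z∈abc = z∈abc
  ... | no z∉abc = ⊥-elim (ℕ.<-irrefl (trans (∣triple∣≡3 a≢b a≢c b≢c) (sym ∣T∣≡3))
                            (p⊂q⇒∣p∣<∣q∣ (triple-⊆ a∈T b∈T c∈T , z , z∈T , z∉abc)))

  triple-≡ : {T : Subset n} → ∣ T ∣ ≡ 3 → {a b c : Fin n} → a ∈ T → b ∈ T → c ∈ T →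
    a ≢ b → a ≢ c → b ≢ c → triple a b c ≡ T
  triple-≡ ∣T∣≡3 a∈T b∈T c∈T a≢b a≢c b≢c =
    ⊆-antisym (triple-⊆ a∈T b∈T c∈T) (triple-complete ∣T∣≡3 a∈T b∈T c∈T a≢b a≢c b≢c)

  ∈-without2⁻ : {a₁ a₂ z : Fin n} → z ∈ without2 a₁ a₂ → z ≢ a₁ × z ≢ a₂
  ∈-without2⁻ z∈ = (λ { refl → x∈∁p⇒x∉p z∈ (∈-pair⁺ (inj₁ refl)) })
                 , (λ { refl → x∈∁p⇒x∉p z∈ (∈-pair⁺ (inj₂ refl)) })

  ∈-without2⁺ : {a₁ a₂ z : Fin n} → z ≢ a₁ → z ≢ a₂ → z ∈ without2 a₁ a₂
  ∈-without2⁺ z≢a₁ z≢a₂ = x∉p⇒x∈∁p λ z∈ → case (∈-pair⁻ z∈)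
    where
    case : _ ⊎ _ → ⊥
    case (inj₁ z≡a₁) = z≢a₁ z≡a₁
    case (inj₂ z≡a₂) = z≢a₂ z≡a₂

length-restrict-tabulate-suc : ∀ {n m} b (T : Subset n) (f : Fin m → Fin n) →
  length (restrict (b ∷ T) (tabulate (Fin.suc ∘ f))) ≡ length (restrict T (tabulate f))
length-restrict-tabulate-suc {m = zero}  b T f = refl
length-restrict-tabulate-suc {m = suc m} b T f with f Fin.zero ∈? T
... | yes _ = cong suc (length-restrict-tabulate-suc b T (f ∘ Fin.suc))
... | no _  = length-restrict-tabulate-suc b T (f ∘ Fin.suc)

length-restrict-allFin : ∀ {n} (T : Subset n) → length (restrict T (allFin n)) ≡ ∣ T ∣
length-restrict-allFin {zero}  Vec.[] = refl
length-restrict-allFin {suc n} (inside ∷ T)  =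
  cong suc (trans (length-restrict-tabulate-suc inside T id) (length-restrict-allFin T))
length-restrict-allFin {suc n} (outside ∷ T) = trans (length-restrict-tabulate-suc outside T id) (length-restrict-allFin T)

module _ {n : ℕ} where

  bottom : Subset n → List (Fin n) → Maybe (Fin n)
  bottom T ω = last (restrict T ω)

  bottom-++ : (T : Subset n) (xs ys : List (Fin n)) → bottom T (xs ++ ys) ≡ bottom T ys <∣> bottom T xs
  bottom-++ T xs ys = trans (cong last (List.filter-++ (_∈? T) xs ys)) (last-++ (restrict T xs) (restrict T ys))

  bottom-++-just : {T : Subset n} (xs : List (Fin n)) {ys : List (Fin n)} {t : Fin n} →
    bottom T ys ≡ just t → bottom T (xs ++ ys) ≡ just t
  bottom-++-just {T} xs {ys} eq = trans (bottom-++ T xs ys) (cong (_<∣> bottom T xs) eq)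

  bottom-above : {T : Subset n} (q : List (Fin n)) {c : Fin n} {r : List (Fin n)} →
    c ∈ T → All (_∉ T) r → bottom T (q ++ c ∷ r) ≡ just c
  bottom-above {T} q {c} {r} c∈T r∉T = bottom-++-just q (begin
    bottom T ([ c ] ++ r)             ≡⟨ bottom-++ T [ c ] r ⟩
    bottom T r <∣> bottom T [ c ]     ≡⟨ cong₂ _<∣>_ (cong last (List.filter-none (_∈? T) r∉T))
                                                     (cong last (List.filter-accept (_∈? T) c∈T)) ⟩
    just c                            ∎)
    where open ≡-Reasoning

  bottom≡nothing⇒avoid : (T : Subset n) (ys : List (Fin n)) → bottom T ys ≡ nothing → All (_∉ T) ys
  bottom≡nothing⇒avoid T ys eq = filter≡[]⇒All∁ (_∈? T) ys (last≡nothing⇒[] (restrict T ys) eq)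

  bottom-∈ : {T : Subset n} (ω : List (Fin n)) {t : Fin n} → bottom T ω ≡ just t → t ∈ₗ ω × t ∈ T
  bottom-∈ {T} ω eq with L , L≡ ← last≡just⇒∷ʳ (restrict T ω) eq =
    ∈-filter⁻ (_∈? T) (subst (_ ∈ₗ_) (sym L≡) (∈-++⁺ʳ L (here refl)))

  bottom-∃ : {T : Subset n} (ω : List (Fin n)) {z : Fin n} → z ∈ₗ ω → z ∈ T → ∃ λ t → bottom T ω ≡ just t
  bottom-∃ {T} ω z∈ω z∈T with bottom T ω in eq
  ... | just t  = t , refl
  ... | nothing = ⊥-elim (All.lookup (bottom≡nothing⇒avoid T ω eq) z∈ω z∈T)

  bottom-restrict : {T S : Subset n} → T ⊆ S → (ω : List (Fin n)) → bottom T (restrict S ω) ≡ bottom T ω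
  bottom-restrict {T} {S} T⊆S ω = cong last (filter-filter-⊆ (_∈? T) (_∈? S) T⊆S ω)

  bottom-⊆ : {P T : Subset n} → P ⊆ T → (ω : List (Fin n)) {t : Fin n} → t ∈ P →
    bottom T ω ≡ just t → bottom P ω ≡ just t
  bottom-⊆ {P} {T} P⊆T ω t∈P eq with L , L≡ ← last≡just⇒∷ʳ (restrict T ω) eq = begin
    bottom P ω                  ≡⟨ bottom-restrict P⊆T ω ⟨
    bottom P (restrict T ω)     ≡⟨ cong (bottom P) L≡ ⟩
    bottom P (L ++ [ _ ])       ≡⟨ bottom-above L t∈P [] ⟩
    just _                      ∎
    where open ≡-Reasoning

  bottom-agree : {T₁ T₂ : Subset n} (ω : List (Fin n)) {p q : Fin n} → p ∈ T₂ → q ∈ T₁ →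
    bottom T₁ ω ≡ just p → bottom T₂ ω ≡ just q → p ≡ q
  bottom-agree {T₁} {T₂} ω {p} {q} p∈T₂ q∈T₁ eq₁ eq₂ = just-injective (begin
    just p              ≡⟨ bottom-⊆ (⊆T q∈T₁ (proj₂ (bottom-∈ ω eq₁))) ω (∈-pair⁺ (inj₁ refl)) eq₁ ⟨
    bottom (pair p q) ω ≡⟨ bottom-⊆ (⊆T (proj₂ (bottom-∈ ω eq₂)) p∈T₂) ω (∈-pair⁺ (inj₂ refl)) eq₂ ⟩
    just q              ∎)
    where
    open ≡-Reasoning
    ⊆T : {T : Subset n} → q ∈ T → p ∈ T → pair p q ⊆ T
    ⊆T q∈T p∈T z∈pq with ∈-pair⁻ z∈pq
    ... | inj₁ refl = p∈T
    ... | inj₂ refl = q∈T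

  restrict-moveDown : {T : Subset n} (p₁ p₂ : List (Fin n)) {c : Fin n} (s : List (Fin n)) → c ∉ T →
    restrict T ((p₁ ++ c ∷ p₂) ++ s) ≡ restrict T ((p₁ ++ p₂) ++ c ∷ s)
  restrict-moveDown {T} p₁ p₂ {c} s c∉T = begin
    R ((p₁ ++ c ∷ p₂) ++ s)     ≡⟨ cong R (List.++-assoc p₁ (c ∷ p₂) s) ⟩
    R (p₁ ++ c ∷ p₂ ++ s)       ≡⟨ List.filter-++ (_∈? T) p₁ (c ∷ p₂ ++ s) ⟩
    R p₁ ++ R (c ∷ p₂ ++ s)     ≡⟨ cong (R p₁ ++_) (List.filter-reject (_∈? T) c∉T) ⟩
    R p₁ ++ R (p₂ ++ s)         ≡⟨ cong (R p₁ ++_) (List.filter-++ (_∈? T) p₂ s) ⟩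
    R p₁ ++ R p₂ ++ R s         ≡⟨ cong (λ l → R p₁ ++ R p₂ ++ l) (List.filter-reject (_∈? T) c∉T) ⟨
    R p₁ ++ R p₂ ++ R (c ∷ s)   ≡⟨ cong (R p₁ ++_) (List.filter-++ (_∈? T) p₂ (c ∷ s)) ⟨
    R p₁ ++ R (p₂ ++ c ∷ s)     ≡⟨ List.filter-++ (_∈? T) p₁ (p₂ ++ c ∷ s) ⟨
    R (p₁ ++ p₂ ++ c ∷ s)       ≡⟨ cong R (List.++-assoc p₁ p₂ (c ∷ s)) ⟨
    R ((p₁ ++ p₂) ++ c ∷ s)     ∎
    where
    open ≡-Reasoning
    R : List (Fin n) → List (Fin n)
    R = restrict T

  bottom-++-cong : {T : Subset n} (xs : List (Fin n)) {ys zs : List (Fin n)} →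
    bottom T ys ≡ bottom T zs → bottom T (xs ++ ys) ≡ bottom T (xs ++ zs)
  bottom-++-cong {T} xs {ys} {zs} eq =
    trans (bottom-++ T xs ys) (trans (cong (_<∣> bottom T xs) eq) (sym (bottom-++ T xs zs)))

  bottom-swap : {T : Subset n} {a b : Fin n} (s : List (Fin n)) →
    bottom T (b ∷ a ∷ s) ≢ bottom T (a ∷ b ∷ s) → a ∈ T × b ∈ T × All (_∉ T) s
  bottom-swap {T} {a} {b} s differ = cases (a ∈? T) (b ∈? T)
    where
    cases : Dec (a ∈ T) → Dec (b ∈ T) → a ∈ T × b ∈ T × All (_∉ T) s
    cases (no a∉T)  _         = ⊥-elim (differ (cong last (sym (restrict-moveDown [] [ b ] s a∉T))))
    cases (yes _)   (no b∉T)  = ⊥-elim (differ (cong last (restrict-moveDown [] [ a ] s b∉T)))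
    cases (yes a∈T) (yes b∈T) with bottom T s in eq
    ... | nothing = a∈T , b∈T , bottom≡nothing⇒avoid T s eq
    ... | just _  = ⊥-elim (differ (trans (bottom-++-just (b ∷ a ∷ []) eq) (sym (bottom-++-just (a ∷ b ∷ []) eq))))

  isPref-length : {ω : List (Fin n)} → IsPref n ω → length ω ≡ n
  isPref-length ω↭ = trans (Perm.↭-length ω↭) (List.length-tabulate id)

  isPref-∈ : {ω : List (Fin n)} → IsPref n ω → (z : Fin n) → z ∈ₗ ω
  isPref-∈ ω↭ z = Perm.∈-resp-↭ (↭-sym ω↭) (∈-allFin z)

  isPref-unique : {ω : List (Fin n)} → IsPref n ω → Unique ω
  isPref-unique ω↭ = PermSetoid.Unique-resp-↭ (setoid (Fin n)) (↭⇒↭ₛ (↭-sym ω↭)) (Unique.allFin⁺ n)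

  nth-restrict-triple : {ω : List (Fin n)} → IsPref n ω → {T : Subset n} → ∣ T ∣ ≡ 3 →
    nth (restrict T ω) 2 ≡ bottom T ω
  nth-restrict-triple {ω} ω↭ {T} ∣T∣≡3 =
    subst (λ k → nth (restrict T ω) (k ∸ 1) ≡ bottom T ω) length≡3 (nth-pred-length (restrict T ω))
    where
    length≡3 : length (restrict T ω) ≡ 3
    length≡3 = trans (Perm.↭-length (Perm.filter-↭ (_∈? T) ω↭)) (trans (length-restrict-allFin T) ∣T∣≡3)

  isBottom⇒bottom : {E : Domain n} → IsDomain n E → {T : Subset n} → ∣ T ∣ ≡ 3 → {z : Fin n} →
    IsBottom (RestrictDom E T) 3 z → ∃ λ ω → E ω × bottom T ω ≡ just z
  isBottom⇒bottom isDom ∣T∣≡3 (_ , (ω , Eω , refl) , eq) =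
    ω , Eω , trans (sym (nth-restrict-triple (isDom ω Eω) ∣T∣≡3)) eq

  bottom⇒isBottom : {E : Domain n} {ω : List (Fin n)} → IsPref n ω → E ω → {T : Subset n} → ∣ T ∣ ≡ 3 →
    {z : Fin n} → bottom T ω ≡ just z → IsBottom (RestrictDom E T) 3 z
  bottom⇒isBottom ω↭ Eω ∣T∣≡3 eq = _ , (_ , Eω , refl) , trans (nth-restrict-triple ω↭ ∣T∣≡3) eq

  isASPD-by-bottom : {E : Domain n} → IsDomain n E →
    (∀ (T : Subset n) → ∣ T ∣ ≡ 3 → ∃ λ z → z ∈ T × ∀ ω → E ω → bottom T ω ≢ just z) → IsASPD n E
  isASPD-by-bottom isDom never T ∣T∣≡3 with z , z∈T , z-never ← never T ∣T∣≡3 =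
    z , z∈T , λ isBot → let ω , Eω , eq = isBottom⇒bottom isDom ∣T∣≡3 isBot in z-never ω Eω eq

singleton-isASPD : ∀ {n} {ω : List (Fin n)} → IsPref n ω → IsASPD n (_≡ ω)
singleton-isASPD {ω = ω} ω↭ = isASPD-by-bottom (λ { _ refl → ω↭ }) λ T ∣T∣≡3 →
  let z , z∈T       = ∣p∣≡3⇒nonempty ∣T∣≡3
      t , bottom≡t  = bottom-∃ ω (isPref-∈ ω↭ z) z∈T
      u , u∈T , u≢t , _ = ∃-third ∣T∣≡3 t t
  in u , u∈T , λ { _ refl bottom≡u → u≢t (just-injective (trans (sym bottom≡u) bottom≡t)) }

module MaximalASPD {n : ℕ} (D : Domain n) (maximal : IsMaximalASPD n D) where

  open DecMembership (_≟ᶠ_ {n}) using () renaming (_∈?_ to _∈ₗ?_)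

  isDomain : IsDomain n D
  isDomain = proj₁ maximal

  isASPD : IsASPD n D
  isASPD = proj₁ (proj₂ maximal)

  Selected : Subset n → Fin n → Set
  Selected T z = Σ (∣ T ∣ ≡ 3) λ h → proj₁ (isASPD T h) ≡ z

  selected : {T : Subset n} → ∣ T ∣ ≡ 3 → ∃ (Selected T)
  selected h = _ , h , refl

  selected-∈ : {T : Subset n} {z : Fin n} → Selected T z → z ∈ T
  selected-∈ {T} (h , refl) = proj₁ (proj₂ (isASPD T h))

  selected-unique : {T : Subset n} {z w : Fin n} → Selected T z → Selected T w → z ≡ w
  selected-unique {T} (h , refl) (h′ , refl) = cong (λ h → proj₁ (isASPD T h)) (ℕ.≡-irrelevant h h′)

  selected? : (T : Subset n) (z : Fin n) → Dec (Selected T z)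
  selected? T z with ∣ T ∣ ℕ.≟ 3
  ... | no ∣T∣≢3 = no (∣T∣≢3 ∘ proj₁)
  ... | yes h with proj₁ (isASPD T h) ≟ᶠ z
  ...   | yes eq = yes (h , eq)
  ...   | no  ne = no λ sel → ne (selected-unique (h , refl) sel)

  Admissible : List (Fin n) → Set
  Admissible ω = ∀ T z → Selected T z → bottom T ω ≢ just z

  D⇒admissible : {ω : List (Fin n)} → D ω → Admissible ω
  D⇒admissible {ω} Dω T z (h , refl) eq = proj₂ (proj₂ (isASPD T h)) (bottom⇒isBottom (isDomain ω Dω) Dω h eq)

  admissible⇒D : {ω : List (Fin n)} → IsPref n ω → Admissible ω → D ω
  admissible⇒D {ω} ω↭ adm =
    proj₂ (proj₂ maximal) E (λ _ → proj₁) (λ _ Dω → isDomain _ Dω , D⇒admissible Dω) isASPD-E ω (ω↭ , adm)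
    where
    -- The admissible preferences form an ASPD containing D.
    E : Domain n
    E ω = IsPref n ω × Admissible ω
    isASPD-E : IsASPD n E
    isASPD-E = isASPD-by-bottom (λ _ → proj₁) λ T h →
      let z , sel = selected h in z , selected-∈ sel , λ { _ (_ , adm) → adm T z sel }

  Tail : List (Fin n) → Set
  Tail s = ∃ λ q → D (q ++ s)

  FitsAbove : List (Fin n) → Fin n → Set
  FitsAbove s c = ∀ T → c ∈ T → All (_∉ T) s → ¬ Selected T c

  fitsAbove? : (s : List (Fin n)) (c : Fin n) → Dec (FitsAbove s c)
  fitsAbove? s c with anySubset? (λ T → c ∈? T ×-dec All.all? (λ z → ¬? (z ∈? T)) s ×-dec selected? T c)
  ... | yes (T , c∈T , s∉T , sel) = no λ fits → fits T c∈T s∉T sel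
  ... | no ∄ = yes λ T c∈T s∉T sel → ∄ (T , c∈T , s∉T , sel)

  fitsAbove-lowest : {q r s : List (Fin n)} {c : Fin n} → D (q ++ c ∷ r) → All (_∈ₗ s) r → FitsAbove s c
  fitsAbove-lowest {q} Dω r⊆s T c∈T s∉T sel =
    D⇒admissible Dω T _ sel (bottom-above q c∈T (All.map (All.lookup s∉T) r⊆s))

  tail-∷⇒fitsAbove : {s : List (Fin n)} {c : Fin n} → Tail (c ∷ s) → FitsAbove s c
  tail-∷⇒fitsAbove (_ , Dω) = fitsAbove-lowest Dω (All.tabulate id)

  tail-∷⇒∉ : {s : List (Fin n)} {c : Fin n} → Tail (c ∷ s) → c ∉ₗ s
  tail-∷⇒∉ (q , Dω) = Unique-++∷⇒∉ q (isPref-unique (isDomain _ Dω))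

  tail-∷ : {s : List (Fin n)} {c : Fin n} → Tail s → c ∉ₗ s → FitsAbove s c → Tail (c ∷ s)
  tail-∷ {s} {c} (q , Dω) c∉s fits with q₁ , q₂ , refl ← ∈-++-∉ q (isPref-∈ (isDomain _ Dω) c) c∉s =
    q₁ ++ q₂ , admissible⇒D (↭-trans (↭-sym (moveDown-↭ q₁ q₂ c s)) (isDomain _ Dω)) admissible
    where
    -- Moving c down only changes the bottom of triples T ∋ c avoiding s, which is now c.
    admissible : Admissible ((q₁ ++ q₂) ++ c ∷ s)
    admissible T z sel with c ∈? T
    ... | no c∉T = D⇒admissible Dω T z sel ∘ trans (cong last (restrict-moveDown q₁ q₂ s c∉T))
    ... | yes c∈T with bottom T s in eq
    ...   | just _  = λ bottom≡z → D⇒admissible Dω T z sel (begin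
      bottom T ((q₁ ++ c ∷ q₂) ++ s)  ≡⟨ bottom-++-just (q₁ ++ c ∷ q₂) eq ⟩
      just _                          ≡⟨ bottom-++-just (q₁ ++ q₂) (bottom-++-just [ c ] eq) ⟨
      bottom T ((q₁ ++ q₂) ++ c ∷ s)  ≡⟨ bottom≡z ⟩
      just z                          ∎)
      where open ≡-Reasoning
    ...   | nothing = λ bottom≡z →
      fits T c∈T s∉T (subst (Selected T) (just-injective (trans (sym bottom≡z) (bottom-above (q₁ ++ q₂) c∈T s∉T))) sel)
      where
      s∉T : All (_∉ T) s
      s∉T = bottom≡nothing⇒avoid T s eq

  lowest-tail : {s ω : List (Fin n)} {z : Fin n} → Tail s → D ω → z ∈ₗ ω → z ∉ₗ s →
    ∃ λ c → Tail (c ∷ s) × ∃₂ λ q r → ω ≡ q ++ c ∷ r × All (_∈ₗ s) r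
  lowest-tail ts Dω z∈ω z∉s with c , c∉s , q , r , refl , r⊆s ← lowest-∉ _≟ᶠ_ _ z∈ω z∉s =
    c , tail-∷ ts c∉s (fitsAbove-lowest Dω r⊆s) , q , r , refl , r⊆s

  tail-grow : {s : List (Fin n)} {z : Fin n} → Tail s → z ∉ₗ s → ∃ λ c → Tail (c ∷ s)
  tail-grow {z = z} ts@(_ , Dω) z∉s with c , tc , _ ← lowest-tail ts Dω (isPref-∈ (isDomain _ Dω) z) z∉s = c , tc

  tail-length : {s : List (Fin n)} → Tail s → length s ≤ n
  tail-length {s} (q , Dω) = ℕ.≤-trans (ℕ.m≤n+m (length s) (length q))
    (ℕ.≤-reflexive (trans (sym (List.length-++ q)) (isPref-length (isDomain _ Dω))))

  tail-full : {s : List (Fin n)} → IsPref n s → Tail s → D s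
  tail-full {s} s↭ ([] , Dω) = Dω
  tail-full {s} s↭ (c ∷ q , Dω) = ⊥-elim (ℕ.m+1+n≰m (length s) (ℕ.≤-reflexive (begin
    length s + suc (length q)   ≡⟨ ℕ.+-comm (length s) (suc (length q)) ⟩
    length (c ∷ q) + length s   ≡⟨ List.length-++ (c ∷ q) ⟨
    length (c ∷ q ++ s)         ≡⟨ isPref-length (isDomain _ Dω) ⟩
    n                           ≡⟨ isPref-length s↭ ⟨
    length s                    ∎)))
    where open ≡-Reasoning

  D⇒tail-[] : {ω : List (Fin n)} → D ω → Tail []
  D⇒tail-[] {ω} Dω = ω , subst D (sym (List.++-identityʳ ω)) Dω

  admissible-stable : {ω : List (Fin n)} → ¬ ¬ Admissible ω → Admissible ω
  admissible-stable ¬¬adm T z sel eq = ¬¬adm λ adm → adm T z sel eq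

  ¬¬nonempty : ¬ ¬ ∃ D
  ¬¬nonempty ∄ = ∄ (allFin n , proj₂ (proj₂ maximal) (_≡ allFin n) (λ { _ refl → ↭-refl })
                                  (λ ω Dω → ⊥-elim (∄ (ω , Dω))) (singleton-isASPD ↭-refl) (allFin n) refl)

  -- Maximality only yields ¬ ¬ ∃ D; a witness is built bottom-up, choosing an
  -- alternative that fits by decidability.
  nonempty : ∃ D
  nonempty = bounded-∷-rec {P = Partial} n partial-length step {s = []}
    (allFin n , allFin↭ , ¬¬-map (D⇒tail-[] ∘ proj₂) ¬¬nonempty)
    where
    allFin↭ : IsPref n (allFin n ++ [])
    allFin↭ = subst (_↭ allFin n) (sym (List.++-identityʳ (allFin n))) ↭-refl
    Partial : List (Fin n) → Set
    Partial s = ∃ λ p → IsPref n (p ++ s) × ¬ ¬ Tail s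
    partial-length : {s : List (Fin n)} → Partial s → length s ≤ n
    partial-length {s} (p , ps↭ , _) = ℕ.≤-trans (ℕ.m≤n+m (length s) (length p))
      (ℕ.≤-reflexive (trans (sym (List.length-++ p)) (isPref-length ps↭)))
    step : {s : List (Fin n)} → Partial s → ∃ D ⊎ ∃ λ c → Partial (c ∷ s)
    step {s} ([] , s↭ , ¬¬ts) =
      inj₁ (s , admissible⇒D s↭ (admissible-stable {s} (¬¬-map (D⇒admissible {s} ∘ tail-full s↭) ¬¬ts)))
    step {s} (u ∷ p , ps↭ , ¬¬ts) with any? (λ c → ¬? (c ∈ₗ? s) ×-dec fitsAbove? s c)
    ... | yes (c , c∉s , fits) = let p′ , moved = ∈-++-∉⇒↭ (u ∷ p) (isPref-∈ ps↭ c) c∉s in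
      inj₂ (c , p′ , ↭-trans (↭-sym moved) ps↭ , ¬¬-map (λ ts → tail-∷ ts c∉s fits) ¬¬ts)
    ... | no ∄ = ⊥-elim (¬¬ts λ ts →
      let c , tcs = tail-grow ts u∉s in ∄ (c , tail-∷⇒∉ tcs , tail-∷⇒fitsAbove tcs))
      where
      u∉s : u ∉ₗ s
      u∉s = Unique-++⇒disjoint (u ∷ p) (isPref-unique ps↭) (here refl)

  tail-suffix : (xs : List (Fin n)) {s : List (Fin n)} → Tail (xs ++ s) → Tail s
  tail-suffix xs {s} (q , Dω) = q ++ xs , subst D (sym (List.++-assoc q xs s)) Dω

  -- D ∪ {ω′} is again an ASPD: the swap only changes the bottom of triples T ⊇ {a, b}
  -- avoiding s, and the third member u of such a T is never a bottom, since in every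
  -- ω ∈ D the lowest alternative outside s fits above s and hence is a.
  swap-sole-fit : {q s : List (Fin n)} {a b : Fin n} →
    (∀ c → c ∉ₗ s → FitsAbove s c → c ≡ a) → D (q ++ b ∷ a ∷ s) → D (q ++ a ∷ b ∷ s)
  swap-sole-fit {q} {s} {a} {b} sole Dω =
    proj₂ (proj₂ maximal) E isDomain-E (λ _ → inj₁) (isASPD-by-bottom isDomain-E never-bottom) ω′ (inj₂ refl)
    where
    ω′ : List (Fin n)
    ω′ = q ++ a ∷ b ∷ s
    E : Domain n
    E ω = D ω ⊎ ω ≡ ω′
    isDomain-E : IsDomain n E
    isDomain-E _ (inj₁ Dω″) = isDomain _ Dω″
    isDomain-E _ (inj₂ refl) = ↭-trans (Perm.++⁺ˡ q (swap a b ↭-refl)) (isDomain _ Dω)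
    never-bottom : (T : Subset n) → ∣ T ∣ ≡ 3 → ∃ λ z → z ∈ T × ∀ ω → E ω → bottom T ω ≢ just z
    never-bottom T h with z , sel ← selected h | ≡-decᵐ _≟ᶠ_ (bottom T ω′) (just z)
    ... | no ω′-z =
      z , selected-∈ sel , λ { _ (inj₁ Dω″) → D⇒admissible Dω″ T z sel ; _ (inj₂ refl) → ω′-z }
    ... | yes ω′-z
      with a∈T , b∈T , s∉T ← bottom-swap s (λ eq → D⇒admissible Dω T z sel (trans (bottom-++-cong q eq) ω′-z))
      with u , u∈T , u≢a , u≢b ← ∃-third h a b =
      u , u∈T , λ { _ (inj₁ Dω″) → not-in-D Dω″ ; _ (inj₂ refl) → not-ω′ }
      where
      not-ω′ : bottom T ω′ ≢ just u
      not-ω′ eq = u≢b (just-injective (trans (sym eq) (bottom-++-just q (bottom-above [ a ] b∈T s∉T))))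
      not-in-D : ∀ {ω} → D ω → bottom T ω ≢ just u
      not-in-D {ω} Dω″ eq
        with c , tcs , q″ , r , refl , r⊆s ← lowest-tail (tail-suffix (b ∷ a ∷ []) (q , Dω)) Dω″
                                               (proj₁ (bottom-∈ ω eq)) (λ u∈s → All.lookup s∉T u∈s u∈T)
        with refl ← sole c (tail-∷⇒∉ tcs) (tail-∷⇒fitsAbove tcs) =
        u≢a (just-injective (trans (sym eq) (bottom-above q″ a∈T (All.map (All.lookup s∉T) r⊆s))))

  another-tail : {s : List (Fin n)} {a b : Fin n} → Tail (b ∷ a ∷ s) → ∃ λ c → c ≢ a × Tail (c ∷ s)
  another-tail {s} {a} {b} (q , Dω) with any? (λ c → ¬? (c ≟ᶠ a) ×-dec ¬? (c ∈ₗ? s) ×-dec fitsAbove? s c)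
  ... | yes (c , c≢a , c∉s , fits) = c , c≢a , tail-∷ (tail-suffix (b ∷ a ∷ []) (q , Dω)) c∉s fits
  ... | no ∄ = ⊥-elim (∄ (b , b≢a , tail-∷⇒∉ tbs , tail-∷⇒fitsAbove tbs))
    where
    b≢a : b ≢ a
    b≢a b≡a = Unique-++∷⇒∉ q (isPref-unique (isDomain _ Dω)) (here b≡a)
    sole : ∀ c → c ∉ₗ s → FitsAbove s c → c ≡ a
    sole c c∉s fits with c ≟ᶠ a
    ... | yes c≡a = c≡a
    ... | no c≢a  = ⊥-elim (∄ (c , c≢a , c∉s , fits))
    tbs : Tail (b ∷ s)
    tbs = tail-suffix [ a ] (q , swap-sole-fit sole Dω)

  tail-[] : Tail []
  tail-[] = D⇒tail-[] (proj₂ nonempty)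

  -- Grow tails avoiding T. Once the alternative a right above the tail is in T,
  -- another-tail gives a second candidate c; if c ∈ T as well, a and c are bottoms of T,
  -- so f(T) is the remaining member and t ∈ {a, c}.
  unselected⇒bottom : {T : Subset n} → ∣ T ∣ ≡ 3 → {t : Fin n} → t ∈ T → ¬ Selected T t →
    ∃ λ ω → D ω × bottom T ω ≡ just t
  unselected⇒bottom {T} h {t} t∈T t-unselected =
    bounded-∷-rec {P = Avoiding} n (tail-length ∘ proj₁) step (tail-[] , [])
    where
    Avoiding : List (Fin n) → Set
    Avoiding s = Tail s × All (_∉ T) s
    realise : {s : List (Fin n)} {c : Fin n} → Tail (c ∷ s) → c ∈ T → All (_∉ T) s →
      ∃ λ ω → D ω × bottom T ω ≡ just c
    realise (q , Dω) c∈T s∉T = _ , Dω , bottom-above q c∈T s∉T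
    no-fourth : {s : List (Fin n)} {a c : Fin n} → Tail (a ∷ s) → Tail (c ∷ s) → All (_∉ T) s →
      a ∈ T → c ∈ T → c ≢ a → t ≢ a → t ≢ c → ⊥
    no-fourth tas tcs s∉T a∈T c∈T c≢a t≢a t≢c with z , sel ← selected h
      with ∈-triple⁻ (triple-complete h a∈T c∈T t∈T (c≢a ∘ sym) (t≢a ∘ sym) (t≢c ∘ sym) (selected-∈ sel))
    ... | inj₁ refl        = tail-∷⇒fitsAbove tas T a∈T s∉T sel
    ... | inj₂ (inj₁ refl) = tail-∷⇒fitsAbove tcs T c∈T s∉T sel
    ... | inj₂ (inj₂ refl) = t-unselected sel
    step : {s : List (Fin n)} → Avoiding s → (∃ λ ω → D ω × bottom T ω ≡ just t) ⊎ ∃ λ c → Avoiding (c ∷ s)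
    step {s} (ts , s∉T) with a , tas ← tail-grow ts (λ t∈s → All.lookup s∉T t∈s t∈T) | a ∈? T
    ... | no a∉T  = inj₂ (a , tas , a∉T ∷ s∉T)
    ... | yes a∈T with t ≟ᶠ a
    ...   | yes refl = inj₁ (realise tas a∈T s∉T)
    ...   | no t≢a with b , tbas ← tail-grow tas (λ { (here t≡a) → t≢a t≡a
                                                      ; (there t∈s) → All.lookup s∉T t∈s t∈T })
                   with c , c≢a , tcs ← another-tail tbas | c ∈? T
    ...     | no c∉T  = inj₂ (c , tcs , c∉T ∷ s∉T)
    ...     | yes c∈T with t ≟ᶠ c
    ...       | yes refl = inj₁ (realise tcs c∈T s∉T)
    ...       | no t≢c = ⊥-elim (no-fourth tas tcs s∉T a∈T c∈T c≢a t≢a t≢c)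

  -- Take ω ∈ D with v below u and z₁; then none of v, z₁, z₂ is the bottom of T in ω.
  above-others⇒unselected : {u v : Fin n} → u ≢ v → {T : Subset n} → ∣ T ∣ ≡ 3 → v ∈ T →
    (∀ {z} → z ∈ T → z ≢ v → Selected (triple u v z) z) → ¬ Selected T v
  above-others⇒unselected {u} {v} u≢v {T} h v∈T others sel-v
    with z₁ , z₁∈T , z₁≢v , _     ← ∃-third h v v
    with z₂ , z₂∈T , z₂≢v , z₂≢z₁ ← ∃-third h v z₁
    with ω , Dω , bottom₁≡v ← unselected⇒bottom (proj₁ (others z₁∈T z₁≢v)) (∈-triple⁺ (inj₂ (inj₁ refl)))
                                (z₁≢v ∘ selected-unique (others z₁∈T z₁≢v))
    with t , bottom≡t ← bottom-∃ ω (isPref-∈ (isDomain ω Dω) v) v∈T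
    with ∈-triple⁻ (triple-complete h v∈T z₁∈T z₂∈T (z₁≢v ∘ sym) (z₂≢v ∘ sym) (z₂≢z₁ ∘ sym)
                                     (proj₂ (bottom-∈ ω bottom≡t)))
  ... | inj₁ refl        = D⇒admissible Dω T v sel-v bottom≡t
  ... | inj₂ (inj₁ refl) = z₁≢v (bottom-agree ω (∈-triple⁺ (inj₂ (inj₂ refl))) v∈T bottom≡t bottom₁≡v)
  ... | inj₂ (inj₂ refl)
    with t₂ , bottom₂≡t₂ ← bottom-∃ ω (isPref-∈ (isDomain ω Dω) z₂)
                                      (∈-triple⁺ {a = u} {b = v} (inj₂ (inj₂ refl)))
    with ∈-triple⁻ {a = u} {b = v} {c = z₂} (proj₂ (bottom-∈ ω bottom₂≡t₂))
  ...   | inj₁ refl        =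
    u≢v (bottom-agree ω (∈-triple⁺ (inj₁ refl)) (∈-triple⁺ (inj₂ (inj₁ refl))) bottom₂≡t₂ bottom₁≡v)
  ...   | inj₂ (inj₁ refl) = z₂≢v (bottom-agree ω (∈-triple⁺ (inj₂ (inj₂ refl))) v∈T bottom≡t bottom₂≡t₂)
  ...   | inj₂ (inj₂ refl) = D⇒admissible Dω _ z₂ (others z₂∈T z₂≢v) bottom₂≡t₂

  isBottom⇒tail : {a : Fin n} → IsBottom D n a → Tail [ a ]
  isBottom⇒tail (ω , Dω , nth≡a) with ω′ , refl ← last≡just⇒∷ʳ ω (trans (sym (nth-pred-length ω))
      (subst (λ k → nth ω (k ∸ 1) ≡ just _) (sym (isPref-length (isDomain ω Dω))) nth≡a)) = ω′ , Dω

  module Pair {x y : Fin n} (x≢y : x ≢ y) where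

    -- z precedes x or y in every preference of D.
    Above : Fin n → Set
    Above z = Selected (triple x y z) z

    above? : (z : Fin n) → Dec (Above z)
    above? z = selected? (triple x y z) z

    above⇒≢ : {z : Fin n} → Above z → z ≢ x × z ≢ y
    above⇒≢ (h , _) = ∣triple∣≡3⇒≢ h

    ¬above-x : ¬ Above x
    ¬above-x above-x = proj₁ (above⇒≢ above-x) refl

    ¬above-y : ¬ Above y
    ¬above-y above-y = proj₂ (above⇒≢ above-y) refl

    Covered : List (Fin n) → Set
    Covered s = ∀ z → z ∉ₗ s → z ≡ x ⊎ z ≡ y ⊎ Above z

    fitsAbove-y : {s : List (Fin n)} → Covered s → FitsAbove s y
    fitsAbove-y {s} covered T y∈T s∉T sel-y with x ∈? T
    ... | yes x∈T with z , z∈T , z≢x , z≢y ← ∃-third (proj₁ sel-y) x y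
                  with covered z (λ z∈s → All.lookup s∉T z∈s z∈T)
    ...   | inj₁ z≡x            = z≢x z≡x
    ...   | inj₂ (inj₁ z≡y)     = z≢y z≡y
    ...   | inj₂ (inj₂ above-z) = z≢y (selected-unique (subst (λ T′ → Selected T′ z) xyz≡T above-z) sel-y)
      where
      xyz≡T : triple x y z ≡ T
      xyz≡T = triple-≡ (proj₁ sel-y) x∈T y∈T z∈T x≢y (z≢x ∘ sym) (z≢y ∘ sym)
    fitsAbove-y {s} covered T y∈T s∉T sel-y | no x∉T =
      above-others⇒unselected x≢y (proj₁ sel-y) y∈T others sel-y
      where
      others : ∀ {z} → z ∈ T → z ≢ y → Above z
      others {z} z∈T z≢y with covered z (λ z∈s → All.lookup s∉T z∈s z∈T)
      ... | inj₁ refl           = ⊥-elim (x∉T z∈T)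
      ... | inj₂ (inj₁ z≡y)     = ⊥-elim (z≢y z≡y)
      ... | inj₂ (inj₂ above-z) = above-z

    fitsAbove-x : {s : List (Fin n)} → Covered s → FitsAbove (y ∷ s) x
    fitsAbove-x {s} covered T x∈T (y∉T ∷ s∉T) sel-x =
      above-others⇒unselected (x≢y ∘ sym) (proj₁ sel-x) x∈T others sel-x
      where
      others : ∀ {z} → z ∈ T → z ≢ x → Selected (triple y x z) z
      others {z} z∈T z≢x with covered z (λ z∈s → All.lookup s∉T z∈s z∈T)
      ... | inj₁ z≡x            = ⊥-elim (z≢x z≡x)
      ... | inj₂ (inj₁ refl)    = ⊥-elim (y∉T z∈T)
      ... | inj₂ (inj₂ above-z) = subst (λ T′ → Selected T′ z) (triple-swap x y z) above-z

    Clear : List (Fin n) → Set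
    Clear s = Tail s × x ∉ₗ s × y ∉ₗ s × All (¬_ ∘ Above) s

    clear-grow : {s : List (Fin n)} {u : Fin n} → Clear s → u ∉ₗ s → u ≢ x → u ≢ y → ¬ Above u →
      ∃ λ c → Clear (c ∷ s)
    clear-grow {s} {u} (ts , x∉s , y∉s , s-low) u∉s u≢x u≢y ¬above-u
      with ω , Dω , bottom≡u ← unselected⇒bottom (∣triple∣≡3 x≢y (u≢x ∘ sym) (u≢y ∘ sym))
                                                 (∈-triple⁺ (inj₂ (inj₂ refl))) ¬above-u
      with c , tcs , q , r , refl , r⊆s ← lowest-tail ts Dω (proj₁ (bottom-∈ ω bottom≡u)) u∉s =
      c , tcs , x∉cs , y∉cs , ¬above-c ∷ s-low
      where
      lowest : ∀ {w} → w ∉ₗ s → c ∈ triple x y w → bottom (triple x y w) (q ++ c ∷ r) ≡ just c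
      lowest {w} w∉s c∈xyw = bottom-above q c∈xyw (All.map (λ v∈s v∈xyw → s∌xyw v∈s (∈-triple⁻ v∈xyw)) r⊆s)
        where
        s∌xyw : ∀ {v} → v ∈ₗ s → v ≡ x ⊎ v ≡ y ⊎ v ≡ w → ⊥
        s∌xyw v∈s (inj₁ refl)        = x∉s v∈s
        s∌xyw v∈s (inj₂ (inj₁ refl)) = y∉s v∈s
        s∌xyw v∈s (inj₂ (inj₂ refl)) = w∉s v∈s
      x∉cs : x ∉ₗ c ∷ s
      x∉cs (here refl)  = u≢x (just-injective (trans (sym bottom≡u) (lowest u∉s (∈-triple⁺ (inj₁ refl)))))
      x∉cs (there x∈s) = x∉s x∈s
      y∉cs : y ∉ₗ c ∷ s
      y∉cs (here refl)  = u≢y (just-injective (trans (sym bottom≡u) (lowest u∉s (∈-triple⁺ (inj₂ (inj₁ refl))))))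
      y∉cs (there y∈s) = y∉s y∈s
      ¬above-c : ¬ Above c
      ¬above-c above-c = D⇒admissible Dω _ c above-c (lowest (tail-∷⇒∉ tcs) (∈-triple⁺ (inj₂ (inj₂ refl))))

    -- The alternatives that are neither x, y nor above are lowered one at a time;
    -- then y and x fit on top.
    top-adjacent : {s : List (Fin n)} → Clear s →
      ∃ λ S → Tail (x ∷ y ∷ S ++ s) × Covered (S ++ s) × All (¬_ ∘ Above) (S ++ s)
    top-adjacent {s} cs = bounded-∷-rec {P = Extends} n (λ ((ts , _) , _) → tail-length ts) step (cs , [] , refl)
      where
      Extends : List (Fin n) → Set
      Extends s′ = Clear s′ × ∃ λ S → s′ ≡ S ++ s
      step : {s′ : List (Fin n)} → Extends s′ →
        (∃ λ S → Tail (x ∷ y ∷ S ++ s) × Covered (S ++ s) × All (¬_ ∘ Above) (S ++ s))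
        ⊎ ∃ λ c → Extends (c ∷ s′)
      step (cs′@(ts , x∉ , y∉ , low) , S , refl)
        with any? (λ u → ¬? (u ∈ₗ? S ++ s) ×-dec ¬? (u ≟ᶠ x) ×-dec ¬? (u ≟ᶠ y) ×-dec ¬? (above? u))
      ... | yes (u , u∉ , u≢x , u≢y , ¬above-u) =
        let c , csc = clear-grow cs′ u∉ u≢x u≢y ¬above-u in inj₂ (c , csc , c ∷ S , refl)
      ... | no ∄ =
        inj₁ (S , tail-∷ (tail-∷ ts y∉ (fitsAbove-y covered)) x∉ys (fitsAbove-x covered) , covered , low)
        where
        covered : Covered (S ++ s)
        covered z z∉ with z ≟ᶠ x | z ≟ᶠ y | above? z
        ... | yes z≡x | _       | _        = inj₁ z≡x
        ... | no _    | yes z≡y | _        = inj₂ (inj₁ z≡y)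
        ... | no _    | no _    | yes a    = inj₂ (inj₂ a)
        ... | no z≢x  | no z≢y  | no ¬a    = ⊥-elim (∄ (z , z∉ , z≢x , z≢y , ¬a))
        x∉ys : x ∉ₗ y ∷ S ++ s
        x∉ys (here x≡y)  = x≢y x≡y
        x∉ys (there x∈s) = x∉ x∈s

    #above : ℕ
    #above = length (filter above? (allFin n))

    count-above : {ω : List (Fin n)} → IsPref n ω → length (filter above? ω) ≡ #above
    count-above ω↭ = Perm.↭-length (Perm.filter-↭ above? ω↭)

    filter-above-++ : (q : List (Fin n)) {s : List (Fin n)} → All (¬_ ∘ Above) s →
      filter above? (q ++ s) ≡ filter above? q
    filter-above-++ q {s} s-low = trans (List.filter-++ above? q s)
      (trans (cong (filter above? q ++_) (List.filter-none above? s-low)) (List.++-identityʳ _))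

    prefix-above : {q s : List (Fin n)} → D (q ++ x ∷ y ∷ s) → Covered s → All Above q
    prefix-above {q} {s} Dω covered =
      All.tabulate λ w∈q → above (Unique-++⇒disjoint q (isPref-unique (isDomain _ Dω)) w∈q)
      where
      above : ∀ {w} → w ∉ₗ x ∷ y ∷ s → Above w
      above {w} w∉ with covered w (w∉ ∘ there ∘ there)
      ... | inj₁ refl        = ⊥-elim (w∉ (here refl))
      ... | inj₂ (inj₁ refl) = ⊥-elim (w∉ (there (here refl)))
      ... | inj₂ (inj₂ a)    = a

    top-position : {q s : List (Fin n)} → D (q ++ x ∷ y ∷ s) → Covered s → All (¬_ ∘ Above) s → length q ≡ #above
    top-position {q} {s} Dω covered s-low = begin
      length q                                     ≡⟨ cong length (List.filter-all above? (prefix-above Dω covered)) ⟨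
      length (filter above? q)                     ≡⟨ cong length (filter-above-++ q (¬above-x ∷ ¬above-y ∷ s-low)) ⟨
      length (filter above? (q ++ x ∷ y ∷ s))      ≡⟨ count-above (isDomain _ Dω) ⟩
      #above                                       ∎
      where open ≡-Reasoning

    AboveAdmissible : List (Fin n) → Set
    AboveAdmissible l = ∀ z → Above z → bottom (triple x y z) l ≢ just z

    below-¬above : (q : List (Fin n)) {u v : Fin n} {r : List (Fin n)} → AboveAdmissible (q ++ u ∷ v ∷ r) →
      x ∉ₗ r → y ∉ₗ r → All (¬_ ∘ Above) r
    below-¬above q {u} {v} {r} adm x∉r y∉r = All.tabulate not-above
      where
      not-above : ∀ {w} → w ∈ₗ r → ¬ Above w
      not-above {w} w∈r above-w
        with t , bottom≡t ← bottom-∃ r w∈r (∈-triple⁺ {a = x} {b = y} (inj₂ (inj₂ refl)))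
        with ∈-triple⁻ {a = x} {b = y} {c = w} (proj₂ (bottom-∈ r bottom≡t))
      ... | inj₁ refl        = x∉r (proj₁ (bottom-∈ r bottom≡t))
      ... | inj₂ (inj₁ refl) = y∉r (proj₁ (bottom-∈ r bottom≡t))
      ... | inj₂ (inj₂ refl) = adm w above-w (bottom-++-just q (bottom-++-just (u ∷ v ∷ []) bottom≡t))

    count-above-before : (q : List (Fin n)) {u v : Fin n} {r : List (Fin n)} → AboveAdmissible (q ++ u ∷ v ∷ r) →
      ¬ Above u → ¬ Above v → x ∉ₗ r → y ∉ₗ r → length (filter above? (q ++ u ∷ v ∷ r)) ≤ length q
    count-above-before q adm ¬above-u ¬above-v x∉r y∉r =
      subst (_≤ length q) (cong length (sym (filter-above-++ q (¬above-u ∷ ¬above-v ∷ below-¬above q adm x∉r y∉r))))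
        (List.length-filter above? q)

    count-above-≤ : {l : List (Fin n)} {k : ℕ} → Unique l → AboveAdmissible l → AdjAt l k x y →
      length (filter above? l) ≤ k
    count-above-≤ {l} {k} uniq adm adj with adjAt⇒++ {l = l} {k = k} {x = x} {y = y} adj
    ... | q , r , refl , inj₁ refl =
      let x∉r , y∉r = Unique-++∷∷⇒∉ q uniq in count-above-before q adm ¬above-x ¬above-y x∉r y∉r
    ... | q , r , refl , inj₂ refl =
      let y∉r , x∉r = Unique-++∷∷⇒∉ q uniq in count-above-before q adm ¬above-y ¬above-x x∉r y∉r

    D-lower-bound : {ω : List (Fin n)} {k : ℕ} → D ω → AdjAt ω k x y → #above ≤ k
    D-lower-bound {ω} {k} Dω adj = subst (_≤ k) (count-above (isDomain ω Dω))
      (count-above-≤ (isPref-unique (isDomain ω Dω)) (λ z above → D⇒admissible Dω _ z above) adj)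

    restrict-lower-bound : {A′ : Subset n} → (∀ {z} → Above z → z ∈ A′) → x ∈ A′ → y ∈ A′ →
      {ω : List (Fin n)} {k : ℕ} → D ω → AdjAt (restrict A′ ω) k x y → #above ≤ k
    restrict-lower-bound {A′} above⇒∈ x∈A′ y∈A′ {ω} {k} Dω adj =
      subst (_≤ k) (trans (cong length (filter-filter-⊆ above? (_∈? A′) above⇒∈ ω)) (count-above (isDomain ω Dω)))
        (count-above-≤ (Unique.filter⁺ (_∈? A′) (isPref-unique (isDomain ω Dω))) admissible adj)
      where
      admissible : AboveAdmissible (restrict A′ ω)
      admissible z above eq =
        D⇒admissible Dω _ z above (trans (sym (bottom-restrict (triple-⊆ x∈A′ y∈A′ (above⇒∈ above)) ω)) eq)

    contiguous : ∃ λ ω → D ω × ∃ λ i → i < n ∸ 1 × AdjAt ω i x y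
    contiguous with S , (q , Dω) , _ ← top-adjacent (tail-[] , (λ ()) , (λ ()) , []) =
      ω , Dω , length q , subst (λ m → length q < m ∸ 1) (isPref-length (isDomain ω Dω)) (adjAt⇒< ω adj) , adj
      where
      ω : List (Fin n)
      ω = q ++ x ∷ y ∷ S ++ []
      adj : AdjAt ω (length q) x y
      adj = inj₁ (adjacent-++ q (S ++ []))

    module _ {a₁ a₂ : Fin n} (a₁≢a₂ : a₁ ≢ a₂) (bottom₁ : IsBottom D n a₁) (bottom₂ : IsBottom D n a₂) where

      tail₁ : Tail [ a₁ ]
      tail₁ = isBottom⇒tail bottom₁

      tail₂ : Tail [ a₂ ]
      tail₂ = isBottom⇒tail bottom₂

      ¬above-bottom : {a : Fin n} → Tail [ a ] → ¬ Above a
      ¬above-bottom ta = tail-∷⇒fitsAbove ta _ (∈-triple⁺ (inj₂ (inj₂ refl))) []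

      above⇒∈A′ : {z : Fin n} → Above z → z ∈ without2 a₁ a₂
      above⇒∈A′ above = ∈-without2⁺ (λ { refl → ¬above-bottom tail₁ above })
                                    (λ { refl → ¬above-bottom tail₂ above })

      clear-bottoms : x ∈ without2 a₁ a₂ → y ∈ without2 a₁ a₂ → Clear (a₂ ∷ a₁ ∷ [])
      clear-bottoms x∈A′ y∈A′ =
        tail-∷ tail₁ (λ { (here a₂≡a₁) → a₁≢a₂ (sym a₂≡a₁) }) (fitsAbove-lowest (proj₂ tail₂) []) ,
        ∉bottoms x∈A′ , ∉bottoms y∈A′ , ¬above-bottom tail₂ ∷ ¬above-bottom tail₁ ∷ []
        where
        ∉bottoms : ∀ {z} → z ∈ without2 a₁ a₂ → z ∉ₗ a₂ ∷ a₁ ∷ []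
        ∉bottoms z∈A′ (here refl)         = proj₂ (∈-without2⁻ z∈A′) refl
        ∉bottoms z∈A′ (there (here refl)) = proj₁ (∈-without2⁻ z∈A′) refl

      topmost : x ∈ without2 a₁ a₂ → y ∈ without2 a₁ a₂ →
        ∃ λ m → IsMinContig D x y m × IsMinContig (Dprime n D a₁ a₂) x y m
      topmost x∈A′ y∈A′ with S , (q , Dω) , covered , low ← top-adjacent (clear-bottoms x∈A′ y∈A′) =
        length q , (contig-D , λ _ (_ , Dω′ , adj) → at-top (D-lower-bound Dω′ adj))
                 , (contig-D′ , λ { _ (_ , (_ , Dω′ , _ , _ , refl) , adj) →
                                    at-top (restrict-lower-bound above⇒∈A′ x∈A′ y∈A′ Dω′ adj) })
        where
        A′ : Subset n
        A′ = without2 a₁ a₂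
        at-top : ∀ {k} → #above ≤ k → length q ≤ k
        at-top {k} = subst (_≤ k) (sym (top-position Dω covered low))
        ω* : List (Fin n)
        ω* = q ++ x ∷ y ∷ S ++ a₂ ∷ a₁ ∷ []
        contig-D : ContigAt D (length q) x y
        contig-D = ω* , Dω , inj₁ (adjacent-++ q (S ++ a₂ ∷ a₁ ∷ []))
        bottoms : nth ω* (n ∸ 1) ≡ just a₁ × nth ω* (n ∸ 2) ≡ just a₂
        bottoms = subst (λ l → nth l (n ∸ 1) ≡ just a₁ × nth l (n ∸ 2) ≡ just a₂) assoc
          (nth-last-two (q ++ x ∷ y ∷ S) (trans (cong length assoc) (isPref-length (isDomain ω* Dω))))
          where
          assoc : (q ++ x ∷ y ∷ S) ++ a₂ ∷ a₁ ∷ [] ≡ ω*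
          assoc = List.++-assoc q (x ∷ y ∷ S) (a₂ ∷ a₁ ∷ [])
        restrict≡ : restrict A′ ω* ≡ q ++ x ∷ y ∷ restrict A′ (S ++ a₂ ∷ a₁ ∷ [])
        restrict≡ = trans (List.filter-++ (_∈? A′) q _)
          (cong₂ _++_ (List.filter-all (_∈? A′) (All.map above⇒∈A′ (prefix-above Dω covered)))
                      (trans (List.filter-accept (_∈? A′) x∈A′) (cong (x ∷_) (List.filter-accept (_∈? A′) y∈A′))))
        contig-D′ : ContigAt (Dprime n D a₁ a₂) (length q) x y
        contig-D′ = restrict A′ ω* , (ω* , Dω , proj₁ bottoms , proj₂ bottoms , refl)
                  , subst (λ l → AdjAt l (length q) x y) (sym restrict≡) (inj₁ (adjacent-++ q _))

lemma4p3 : (n : ℕ) (D : Domain n) → IsMaximalASPD n D →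
    (x y : Fin n) → x ≢ y →
    (∃ λ ω → D ω × ∃ λ i → i < n ∸ 1 × AdjAt ω i x y)
    ×
    (3 ≤ n → (a₁ a₂ : Fin n) → a₁ ≢ a₂ → IsBottom D n a₁ → IsBottom D n a₂ →
      x ∈ without2 a₁ a₂ → y ∈ without2 a₁ a₂ →
      ∃ λ m → IsMinContig D x y m × IsMinContig (Dprime n D a₁ a₂) x y m)
lemma4p3 n D maximal x y x≢y = contiguous , λ _ a₁ a₂ a₁≢a₂ bottom₁ bottom₂ → topmost a₁≢a₂ bottom₁ bottom₂
  where
  open MaximalASPD D maximal
  open Pair x≢y
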